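{- Let $f:A\to B$ be a surjective group homomorphism. If $B$ is telescopic, then $A$ is telescopic.
   Context: For a group $G$ and $H\le G$, $N_G(H)=\{g\in G: gHg^{ -1}=H\}$. A group $T$ is telescopic if for every finite group $\Gamma$ there exists a finite-index subgroup $H\le T$ with $N_T(H)/H\cong\Gamma$. -}

module Defs where

open import Level using (Level; _⊔_; suc)
open import Data.Nat.Base using (ℕ)
open import Data.Fin.Base using (Fin)
open import Data.Product.Base using (Σ; Σ-syntax; ∃; _×_; _,_; proj₁; proj₂)
open import Data.Vec.Base using ([]; _∷_)
import Relation.Binary.PropositionalEquality.Core as P
open import Algebra.Bundles using (Group; RawGroup)
open import Algebra.Morphism.Structures using (IsGroupHomomorphism; IsGroupIsomorphism)
open import Function.Definitions using (Surjective)

module GroupNotions {c ℓ : Level} (G : Group c ℓ) where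
  open Group G
  open import Relation.Binary.Reasoning.Setoid setoid
  open import Algebra.Properties.Group G using (⁻¹-anti-homo-∙; ⁻¹-involutive)
  open import Algebra.Solver.Monoid monoid using (solve; _⊜_; _⊕_)

  record IsSubgroup {p : Level} (H : Carrier → Set p) : Set (c ⊔ ℓ ⊔ p) where
    field
      ∈-resp : ∀ {x y} → x ≈ y → H x → H y
      ε-∈    : H ε
      ∙-∈    : ∀ {x y} → H x → H y → H (x ∙ y)
      ⁻¹-∈   : ∀ {x} → H x → H (x ⁻¹)

  -- H has finite index in G: finitely many left cosets r i H cover G.
  FiniteIndex : {p : Level} → (Carrier → Set p) → Set (c ⊔ p)
  FiniteIndex H = Σ[ n ∈ ℕ ] Σ[ r ∈ (Fin n → Carrier) ] (∀ g → Σ[ i ∈ Fin n ] H (r i ⁻¹ ∙ g))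

  Conj : {p : Level} → Carrier → (Carrier → Set p) → Carrier → Set (c ⊔ ℓ ⊔ p)
  Conj g H x = Σ[ h ∈ Carrier ] (H h × x ≈ g ∙ h ∙ g ⁻¹)

  InNormalizer : {p : Level} → (Carrier → Set p) → Carrier → Set (c ⊔ ℓ ⊔ p)
  InNormalizer H g = ∀ x → (Conj g H x → H x) × (H x → Conj g H x)

  private
    lemA : ∀ a b h → a ∙ (b ∙ h ∙ b ⁻¹) ∙ a ⁻¹ ≈ (a ∙ b) ∙ h ∙ (a ∙ b) ⁻¹
    lemA a b h = begin
      a ∙ (b ∙ h ∙ b ⁻¹) ∙ a ⁻¹     ≈⟨ solve 5 (λ a b h b' a' → (a ⊕ ((b ⊕ h) ⊕ b')) ⊕ a' ⊜ ((a ⊕ b) ⊕ h) ⊕ (b' ⊕ a')) (Group.refl G) a b h (b ⁻¹) (a ⁻¹) ⟩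
      (a ∙ b) ∙ h ∙ (b ⁻¹ ∙ a ⁻¹)   ≈⟨ ∙-congˡ (sym (⁻¹-anti-homo-∙ a b)) ⟩
      (a ∙ b) ∙ h ∙ (a ∙ b) ⁻¹      ∎

    lemC : ∀ g k → g ⁻¹ ∙ (g ∙ k ∙ g ⁻¹) ∙ g ≈ k
    lemC g k = begin
      g ⁻¹ ∙ (g ∙ k ∙ g ⁻¹) ∙ g     ≈⟨ solve 3 (λ g' g k → (g' ⊕ ((g ⊕ k) ⊕ g')) ⊕ g ⊜ ((g' ⊕ g) ⊕ k) ⊕ (g' ⊕ g)) (Group.refl G) (g ⁻¹) g k ⟩
      (g ⁻¹ ∙ g) ∙ k ∙ (g ⁻¹ ∙ g)   ≈⟨ ∙-cong (∙-congʳ (inverseˡ g)) (inverseˡ g) ⟩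
      ε ∙ k ∙ ε                     ≈⟨ identityʳ _ ⟩
      ε ∙ k                         ≈⟨ identityˡ k ⟩
      k                             ∎

    lemC' : ∀ g k → g ⁻¹ ∙ (g ∙ k ∙ g ⁻¹) ∙ g ⁻¹ ⁻¹ ≈ k
    lemC' g k = trans (∙-congˡ (⁻¹-involutive g)) (lemC g k)

    lemD : ∀ h → ε ∙ h ∙ ε ⁻¹ ≈ h
    lemD h = begin
      ε ∙ h ∙ ε ⁻¹  ≈⟨ ∙-cong (identityˡ h) ε⁻¹≈ε ⟩
      h ∙ ε         ≈⟨ identityʳ h ⟩
      h             ∎
      where
      ε⁻¹≈ε : ε ⁻¹ ≈ ε
      ε⁻¹≈ε = trans (sym (identityˡ (ε ⁻¹))) (inverseʳ ε)

  module _ {p : Level} {H : Carrier → Set p} (sg : IsSubgroup H) where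
    open IsSubgroup sg

    N-ε : InNormalizer H ε
    N-ε x = (λ { (h , h∈ , eq) → ∈-resp (sym (trans eq (lemD h))) h∈ })
          , (λ x∈ → x , x∈ , sym (lemD x))

    N-∙ : ∀ {a b} → InNormalizer H a → InNormalizer H b → InNormalizer H (a ∙ b)
    N-∙ {a} {b} Na Nb x =
        (λ { (h , h∈ , eq) →
               ∈-resp (sym (trans eq (sym (lemA a b h))))
                 (proj₁ (Na _) (b ∙ h ∙ b ⁻¹ , proj₁ (Nb _) (h , h∈ , refl′) , refl′)) })
      , (λ x∈ → let (k , k∈ , eqk) = proj₂ (Na x) x∈
                    (m , m∈ , eqm) = proj₂ (Nb k) k∈
                in m , m∈ , trans eqk (trans (∙-congʳ (∙-congˡ eqm)) (lemA a b m)))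
      where refl′ = Group.refl G

    N-⁻¹ : ∀ {g} → InNormalizer H g → InNormalizer H (g ⁻¹)
    N-⁻¹ {g} Ng x =
        (λ { (h , h∈ , eq) →
               let (k , k∈ , eqk) = proj₂ (Ng h) h∈
               in ∈-resp (sym (trans eq (trans (∙-congʳ (∙-congˡ eqk)) (lemC' g k)))) k∈ })
      , (λ x∈ → g ∙ x ∙ g ⁻¹ , proj₁ (Ng _) (x , x∈ , Group.refl G) , sym (lemC' g x))

    -- The quotient N_G(H)/H as a raw group: elements of the normalizer,
    -- with x ~ y iff x⁻¹ y ∈ H (equality of left cosets xH = yH).
    NormQuotient : RawGroup (c ⊔ ℓ ⊔ p) p
    NormQuotient = record
      { Carrier = Σ[ g ∈ Carrier ] InNormalizer H g
      ; _≈_     = λ x y → H (proj₁ x ⁻¹ ∙ proj₁ y)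
      ; _∙_     = λ x y → (proj₁ x ∙ proj₁ y) , N-∙ (proj₂ x) (proj₂ y)
      ; ε       = ε , N-ε
      ; _⁻¹     = λ x → (proj₁ x ⁻¹) , N-⁻¹ (proj₂ x)
      }

IsFiniteGroup : {a b : Level} → Group a b → Set (a ⊔ b)
IsFiniteGroup Γ = Σ[ n ∈ ℕ ] Σ[ e ∈ (Fin n → Carrier) ] (∀ x → Σ[ i ∈ Fin n ] (e i ≈ x))
  where open Group Γ

_≅_ : {a b a' b' : Level} → RawGroup a b → RawGroup a' b' → Set (a ⊔ b ⊔ a' ⊔ b')
R₁ ≅ R₂ = Σ[ φ ∈ (RawGroup.Carrier R₁ → RawGroup.Carrier R₂) ] IsGroupIsomorphism R₁ R₂ φ

Telescopic : {c ℓ : Level} (p γc γℓ : Level) → Group c ℓ → Set (c ⊔ ℓ ⊔ suc p ⊔ suc γc ⊔ suc γℓ)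
Telescopic p γc γℓ T =
  (Γ : Group γc γℓ) → IsFiniteGroup Γ →
  Σ[ H ∈ (Carrier → Set p) ] Σ[ sg ∈ IsSubgroup H ]
    (FiniteIndex H × (NormQuotient sg ≅ Group.rawGroup Γ))
  where open Group T using (Carrier)
        open GroupNotions T

IsSurjectiveHom : {a b a' b' : Level} (A : Group a b) (B : Group a' b') →
                  (Group.Carrier A → Group.Carrier B) → Set (a ⊔ b ⊔ a' ⊔ b')
IsSurjectiveHom A B f =
  IsGroupHomomorphism (Group.rawGroup A) (Group.rawGroup B) f ×
  Surjective (Group._≈_ A) (Group._≈_ B) f

module Submission where

-- Let f : A → B be a surjective homomorphism and H ≤ B a subgroup.  The
-- preimage H' = f⁻¹(H) is a subgroup of A, and we show:
--   * H' has finite index in A whenever H has finite index in B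
--     (lifts of coset representatives of H are coset representatives of H');
--   * g normalizes H' exactly when f g normalizes H, i.e. f maps
--     N_A(H') onto N_B(H);
--   * the induced map N_A(H')/H' → N_B(H)/H is a group isomorphism, since
--     x⁻¹y ∈ H' holds by definition iff f(x)⁻¹ f(y) ∈ H.
-- Given a finite group Γ, telescopicity of B yields H with N_B(H)/H ≅ Γ;
-- composing with the isomorphism above shows that f⁻¹(H) witnesses
-- telescopicity of A for Γ.

open import Defs
open import Level using (Level)
open import Algebra.Bundles using (Group)
open import Data.Product.Base using (Σ-syntax; _,_; proj₁; proj₂)
open import Algebra.Morphism.Structures using (IsGroupHomomorphism; IsGroupIsomorphism)
import Algebra.Morphism.Construct.Composition as Composition

module ConjugationProperties {c ℓ : Level} (G : Group c ℓ) where
  open Group G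
  open import Relation.Binary.Reasoning.Setoid setoid
  open import Algebra.Solver.Monoid monoid using (solve; _⊜_; _⊕_)

  conj-conj⁻¹ : ∀ a x → a ∙ (a ⁻¹ ∙ x ∙ a) ∙ a ⁻¹ ≈ x
  conj-conj⁻¹ a x = begin
    a ∙ (a ⁻¹ ∙ x ∙ a) ∙ a ⁻¹    ≈⟨ solve 3 (λ a a' x → (a ⊕ ((a' ⊕ x) ⊕ a)) ⊕ a' ⊜ ((a ⊕ a') ⊕ x) ⊕ (a ⊕ a'))
                                          refl a (a ⁻¹) x ⟩
    (a ∙ a ⁻¹) ∙ x ∙ (a ∙ a ⁻¹)  ≈⟨ ∙-cong (∙-congʳ (inverseʳ a)) (inverseʳ a) ⟩
    ε ∙ x ∙ ε                    ≈⟨ identityʳ _ ⟩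
    ε ∙ x                        ≈⟨ identityˡ x ⟩
    x                            ∎

module Preimage {a b a' b' p : Level} (A : Group a b) (B : Group a' b')
  (f : Group.Carrier A → Group.Carrier B)
  (f-hom : IsGroupHomomorphism (Group.rawGroup A) (Group.rawGroup B) f)
  (H : Group.Carrier B → Set p) (H-subgroup : GroupNotions.IsSubgroup B H) where

  private
    module A = Group A
    module B = Group B
    module NA = GroupNotions A
    module NB = GroupNotions B
  open NB.IsSubgroup H-subgroup
  open IsGroupHomomorphism f-hom
  open import Algebra.Properties.Group B using (⁻¹-involutive)

  f-left-divide : ∀ x y → f (x A.⁻¹ A.∙ y) B.≈ f x B.⁻¹ B.∙ f y
  f-left-divide x y = B.trans (homo _ _) (B.∙-congʳ (⁻¹-homo x))

  f-triple : ∀ u v w → f (u A.∙ v A.∙ w) B.≈ f u B.∙ f v B.∙ f w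
  f-triple u v w = B.trans (homo _ _) (B.∙-congʳ (homo _ _))

  f-conj : ∀ g x → f (g A.∙ x A.∙ g A.⁻¹) B.≈ f g B.∙ f x B.∙ f g B.⁻¹
  f-conj g x = B.trans (f-triple _ _ _) (B.∙-congˡ (⁻¹-homo g))

  ≈⇒same-coset : ∀ {u v} → u B.≈ v → H (u B.⁻¹ B.∙ v)
  ≈⇒same-coset {u} {v} u≈v =
    ∈-resp (B.sym (B.trans (B.∙-congʳ (B.⁻¹-cong u≈v)) (B.inverseˡ v))) ε-∈

  H' : A.Carrier → Set p
  H' x = H (f x)

  H'-subgroup : NA.IsSubgroup H'
  H'-subgroup = record
    { ∈-resp = λ x≈y → ∈-resp (⟦⟧-cong x≈y)
    ; ε-∈    = ∈-resp (B.sym ε-homo) ε-∈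
    ; ∙-∈    = λ hx hy → ∈-resp (B.sym (homo _ _)) (∙-∈ hx hy)
    ; ⁻¹-∈   = λ hx → ∈-resp (B.sym (⁻¹-homo _)) (⁻¹-∈ hx)
    }

  -- Inclusion
  -- a H' a⁻¹ ⊆ H' is pushed through f; for the converse, x ∈ H' is written as
  -- a (a⁻¹ x a) a⁻¹ and a⁻¹ x a ∈ H' because g⁻¹ also normalizes H.
  normalizer-preimage : ∀ {a g} → f a B.≈ g → NB.InNormalizer H g → NA.InNormalizer H' a
  normalizer-preimage {a} {g} fa≈g g-norm x = conj⊆H' , H'⊆conj
    where
    conj⊆H' : NA.Conj a H' x → H' x
    conj⊆H' (h , fh∈H , x≈aha⁻¹) = proj₁ (g-norm (f x)) (f h , fh∈H , fx≈conj)
      where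
      fx≈conj : f x B.≈ g B.∙ f h B.∙ g B.⁻¹
      fx≈conj = B.trans (⟦⟧-cong x≈aha⁻¹)
                  (B.trans (f-conj a h) (B.∙-cong (B.∙-congʳ fa≈g) (B.⁻¹-cong fa≈g)))

    f-conj⁻¹ : f (a A.⁻¹ A.∙ x A.∙ a) B.≈ g B.⁻¹ B.∙ f x B.∙ g B.⁻¹ B.⁻¹
    f-conj⁻¹ = B.trans (f-triple _ _ _)
                 (B.∙-cong (B.∙-congʳ (B.trans (⁻¹-homo a) (B.⁻¹-cong fa≈g)))
                           (B.trans fa≈g (B.sym (⁻¹-involutive g))))

    H'⊆conj : H' x → NA.Conj a H' x
    H'⊆conj fx∈H =
      (a A.⁻¹ A.∙ x A.∙ a) ,
      proj₁ (NB.N-⁻¹ H-subgroup g-norm _) (f x , fx∈H , f-conj⁻¹) ,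
      A.sym (ConjugationProperties.conj-conj⁻¹ A a x)

module SurjectivePreimage {a b a' b' p : Level} (A : Group a b) (B : Group a' b')
  (f : Group.Carrier A → Group.Carrier B) (f-surjHom : IsSurjectiveHom A B f)
  (H : Group.Carrier B → Set p) (H-subgroup : GroupNotions.IsSubgroup B H) where

  private
    module A = Group A
    module B = Group B
    module NA = GroupNotions A
    module NB = GroupNotions B
  open NB.IsSubgroup H-subgroup
  open IsGroupHomomorphism (proj₁ f-surjHom)
  open Preimage A B f (proj₁ f-surjHom) H H-subgroup public

  lift : B.Carrier → A.Carrier
  lift y = proj₁ (proj₂ f-surjHom y)

  f-lift : ∀ y → f (lift y) B.≈ y
  f-lift y = proj₂ (proj₂ f-surjHom y) A.refl

  finiteIndex-preimage : NB.FiniteIndex H → NA.FiniteIndex H'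
  finiteIndex-preimage (n , r , covers) = n , (λ i → lift (r i)) , covers'
    where
    covers' : ∀ g → Σ[ i ∈ _ ] H' (lift (r i) A.⁻¹ A.∙ g)
    covers' g with covers (f g)
    ... | i , r⁻¹fg∈H = i , ∈-resp (B.sym f-quotient) r⁻¹fg∈H
      where
      f-quotient : f (lift (r i) A.⁻¹ A.∙ g) B.≈ r i B.⁻¹ B.∙ f g
      f-quotient = B.trans (f-left-divide _ _) (B.∙-congʳ (B.⁻¹-cong (f-lift (r i))))

  -- f maps N_A(H') into N_B(H).  Each element of H, or of a conjugate of H,
  -- is reached from A by lifting, so the two inclusions transfer along f.
  normalizer-image : ∀ {g} → NA.InNormalizer H' g → NB.InNormalizer H (f g)
  normalizer-image {g} g-norm y = conj⊆H , H⊆conj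
    where
    conj⊆H : NB.Conj (f g) H y → H y
    conj⊆H (h , h∈H , y≈conj) = ∈-resp fconj≈y (proj₁ (g-norm _) (lift h , lift-h∈H' , A.refl))
      where
      lift-h∈H' : H' (lift h)
      lift-h∈H' = ∈-resp (B.sym (f-lift h)) h∈H

      fconj≈y : f (g A.∙ lift h A.∙ g A.⁻¹) B.≈ y
      fconj≈y = B.trans (f-conj g (lift h))
                  (B.trans (B.∙-congʳ (B.∙-congˡ (f-lift h))) (B.sym y≈conj))

    H⊆conj : H y → NB.Conj (f g) H y
    H⊆conj y∈H with proj₂ (g-norm (lift y)) (∈-resp (B.sym (f-lift y)) y∈H)
    ... | h , h∈H' , lift-y≈conj =
      f h , h∈H' , B.trans (B.sym (f-lift y)) (B.trans (⟦⟧-cong lift-y≈conj) (f-conj g h))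

  induced : Σ[ g ∈ A.Carrier ] NA.InNormalizer H' g → Σ[ g ∈ B.Carrier ] NB.InNormalizer H g
  induced (g , g-norm) = f g , normalizer-image g-norm

  -- It is an isomorphism: the quotient relations correspond exactly under f
  -- (giving well-definedness and injectivity), homomorphism laws are those
  -- of f, and surjectivity uses lifts together with normalizer-preimage.
  induced-isomorphism : IsGroupIsomorphism (NA.NormQuotient H'-subgroup) (NB.NormQuotient H-subgroup) induced
  induced-isomorphism = record
    { isGroupMonomorphism = record
      { isGroupHomomorphism = record
        { isMonoidHomomorphism = record
          { isMagmaHomomorphism = record
            { isRelHomomorphism = record
              { cong = λ {x} {y} → ∈-resp (f-left-divide (proj₁ x) (proj₁ y)) }
            ; homo = λ x y → ≈⇒same-coset (homo (proj₁ x) (proj₁ y))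
            }
          ; ε-homo = ≈⇒same-coset ε-homo
          }
        ; ⁻¹-homo = λ x → ≈⇒same-coset (⁻¹-homo (proj₁ x))
        }
      ; injective = λ {x} {y} → ∈-resp (B.sym (f-left-divide (proj₁ x) (proj₁ y)))
      }
    ; surjective = λ { (g , g-norm) →
        (lift g , normalizer-preimage (f-lift g) g-norm) ,
        λ {z} → ∈-resp (B.trans (f-left-divide (proj₁ z) (lift g)) (B.∙-congˡ (f-lift g))) }
    }

lemma3p4 : {a b a' b' : Level} (p γc γℓ : Level) (A : Group a b) (B : Group a' b')
           (f : Group.Carrier A → Group.Carrier B) →
           IsSurjectiveHom A B f →
           Telescopic p γc γℓ B → Telescopic p γc γℓ A
lemma3p4 p γc γℓ A B f f-surjHom B-telescopic Γ Γ-finite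
  with B-telescopic Γ Γ-finite
... | H , H-subgroup , H-finiteIndex , φ , φ-isomorphism =
  H' , H'-subgroup , finiteIndex-preimage H-finiteIndex , (λ x → φ (induced x)) ,
  Composition.isGroupIsomorphism (Group.trans Γ) induced-isomorphism φ-isomorphism
  where open SurjectivePreimage A B f f-surjHom H H-subgroup
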